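{- Let $\Delta$ be a simple graph on vertex set $V=[n]$ and $k\ge0$ an integer. Let $\chi^{\mathrm{set}}_\Delta(k)$ be the number of functions $c:V\to\mathcal{P}_k$ such that $|c(i)|\ne|c(j)|$ whenever $i,j$ are adjacent in $\Delta$. Then \[ \chi^{\mathrm{set}}_\Delta(k)=\sum_{\pi\in\Pi(\Delta)}\mu(\hat0,\pi)\prod_{B\in\pi}\mathrm{Fr}(k,|B|), \qquad\text{where } \mathrm{Fr}(k,r)=\sum_{j=0}^k\binom{k}{j}^r, \] and $\mu$ is the Möbius function of $\Pi(\Delta)$.
   Context: $\mathcal{P}_k$ is the power set of $[k]=\{1,\dots,k\}$. $\Pi(\Delta)$ is the set of partitions $\pi$ of $V$ such that each block induces a connected subgraph of $\Delta$, ordered by refinement, with bottom element $\hat0$ the partition into singletons. -}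

module Defs where

open import Data.Nat using (ℕ; zero; suc; _^_; _≤_)
import Data.Nat as ℕ
open import Data.Nat.Combinatorics using (_C_)
open import Data.Integer using (ℤ; _+_; _*_; +_)
open import Data.Fin using (Fin; toℕ; _≟_)
open import Data.Fin.Properties using (all?)
open import Data.Fin.Subset using (Subset; ∣_∣)
open import Data.Vec using (Vec; lookup; tabulate)
open import Data.List using (List; []; _∷_; map; filter; length; upTo; allFin; foldr)
open import Data.List.Membership.Propositional using (_∈_)
open import Data.List.Relation.Unary.Unique.Propositional using (Unique)
open import Relation.Binary.PropositionalEquality using (_≡_; _≢_)
open import Relation.Nullary using (Dec)
open import Relation.Nullary.Decidable using (_→-dec_)
open import Function using (id)
import Data.Empty
import Data.Product

record SimpleGraph (n : ℕ) : Set₁ where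
  field
    Adj    : Fin n → Fin n → Set
    sym    : ∀ {i j} → Adj i j → Adj j i
    irrefl : ∀ {i} → Adj i i → Data.Empty.⊥
open SimpleGraph public

-- Set partitions of Fin n are encoded by their "minimum-representative map":
-- p i is the least element of the block containing i.
PartRep : ℕ → Set
PartRep n = Vec (Fin n) n

IsPartition : ∀ {n} → PartRep n → Set
IsPartition {n} p = ∀ (i : Fin n) → (toℕ (lookup p i) ≤ toℕ i) Data.Product.× (lookup p (lookup p i) ≡ lookup p i)

SameBlock : ∀ {n} → PartRep n → Fin n → Fin n → Set
SameBlock p i j = lookup p i ≡ lookup p j

data WalkIn {n} (G : SimpleGraph n) (InB : Fin n → Set) : Fin n → Fin n → Set where
  nil  : ∀ {i} → InB i → WalkIn G InB i i
  cons : ∀ {i j l} → InB i → Adj G i j → WalkIn G InB j l → WalkIn G InB i l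

BlocksConnected : ∀ {n} → SimpleGraph n → PartRep n → Set
BlocksConnected {n} G p = ∀ (i j : Fin n) → SameBlock p i j → WalkIn G (λ v → lookup p v ≡ lookup p i) i j

InΠ : ∀ {n} → SimpleGraph n → PartRep n → Set
InΠ G p = IsPartition p Data.Product.× BlocksConnected G p

Refines : ∀ {n} → PartRep n → PartRep n → Set
Refines {n} σ π = ∀ (i j : Fin n) → SameBlock σ i j → SameBlock π i j

refines? : ∀ {n} (σ π : PartRep n) → Dec (Refines σ π)
refines? σ π = all? (λ i → all? (λ j → (lookup σ i ≟ lookup σ j) →-dec (lookup π i ≟ lookup π j)))

bottom : ∀ {n} → PartRep n
bottom = tabulate id

sumℤ : List ℤ → ℤ
sumℤ = foldr _+_ (+ 0)

sumℕ : List ℕ → ℕ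
sumℕ = foldr ℕ._+_ 0

prodℕ : List ℕ → ℕ
prodℕ = foldr ℕ._*_ 1

Fr : ℕ → ℕ → ℕ
Fr k r = sumℕ (map (λ j → (k C j) ^ r) (upTo (suc k)))

blockSize : ∀ {n} → PartRep n → Fin n → ℕ
blockSize {n} p r = length (filter (λ j → lookup p j ≟ r) (allFin n))

-- Π_{B ∈ π} Fr(k,|B|): blocks are indexed by their representatives r (p r ≡ r)
blockProduct : ∀ {n} → ℕ → PartRep n → ℕ
blockProduct {n} k p = prodℕ (map (λ r → Fr k (blockSize p r)) (filter (λ r → lookup p r ≟ r) (allFin n)))

EnumeratesΠ : ∀ {n} → SimpleGraph n → List (PartRep n) → Set
EnumeratesΠ G L = Unique L Data.Product.× (∀ p → (p ∈ L → InΠ G p) Data.Product.× (InΠ G p → p ∈ L))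

IsMöbiusFromBottom : ∀ {n} → List (PartRep n) → (PartRep n → ℤ) → Set
IsMöbiusFromBottom L m = ∀ π → π ∈ L →
  ((π ≡ bottom → sumℤ (map m (filter (λ σ → refines? σ π) L)) ≡ + 1) Data.Product.×
   (π ≢ bottom → sumℤ (map m (filter (λ σ → refines? σ π) L)) ≡ + 0))

IsSetColoring : ∀ {n} → SimpleGraph n → (k : ℕ) → Vec (Subset k) n → Set
IsSetColoring G k c = ∀ i j → Adj G i j → ∣ lookup c i ∣ ≢ ∣ lookup c j ∣

EnumeratesColorings : ∀ {n} → SimpleGraph n → (k : ℕ) → List (Vec (Subset k) n) → Set
EnumeratesColorings G k C = Unique C Data.Product.× (∀ c → (c ∈ C → IsSetColoring G k c) Data.Product.× (IsSetColoring G k c → c ∈ C))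

-- Fix any c : V → P_k and put f i = |c(i)|. Among the partitions in Π(Δ) on whose blocks f is
-- constant, one with least sum of block representatives is the largest: if some σ on which f is
-- constant were not below it, a walk inside a block of σ would use an edge joining two blocks of
-- that minimiser on which f agrees, and merging these two blocks would keep every block connected
-- and f constant while lowering the sum. The minimiser is 0̂ exactly when c is proper, so
-- Σ_{σ : f constant on σ} μ(0̂,σ) = Σ_{σ ≤ minimiser} μ(0̂,σ) = [c proper]. Summing over all c and
-- exchanging the sums, χ^set(k) = Σ_σ μ(0̂,σ) N(σ), where N(σ) counts the c with |c| constant on
-- the blocks of σ. Choosing a common size j for a block B and a j-subset for each of its vertices
-- gives N(σ) = Π_B Σ_j (k choose j)^|B| = Π_B Fr(k,|B|).
module Submission where

open import Defs hiding (sym)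
open import Algebra.Bundles using (CommutativeMonoid; CommutativeSemiring)
open import Data.Bool as Bool using (true; false; if_then_else_)
open import Data.Empty using (⊥-elim)
open import Data.Fin using (Fin; zero; suc; toℕ; _≟_)
open import Data.Fin.Properties using (all?)
import Data.Fin.Properties as Fin
open import Data.Fin.Subset using (Subset; ∣_∣)
import Data.Integer.Properties as ℤ
open import Data.List using (List; []; _∷_; _++_; map; foldr; filter; length; allFin; cartesianProductWith)
open import Data.List.Extrema.Nat using (argmin; argmin-all; f[argmin]≤f[xs])
open import Data.List.Membership.Propositional using (_∈_)
open import Data.List.Membership.Propositional.Properties using (∈-allFin; ∈-filter⁺; ∈-filter⁻)
open import Data.List.Membership.Propositional.Properties.WithK using (unique∧set⇒bag)
import Data.List.Membership.DecPropositional as DecMembership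
open import Data.List.Properties using (map-∘; map-tabulate)
open import Data.List.Relation.Binary.BagAndSetEquality using (∼bag⇒↭)
open import Data.List.Relation.Binary.Permutation.Propositional.Properties using (↭-length)
import Data.List.Relation.Unary.All as All
open import Data.List.Relation.Unary.Any using (here; there)
open import Data.List.Relation.Unary.Unique.Propositional using (Unique)
import Data.List.Relation.Unary.Unique.Propositional.Properties as Unique
open import Data.Nat using (ℕ; zero; suc; _≤_; _<_)
import Data.Nat.Properties as ℕ
open import Data.Product using (Σ-syntax; _×_; _,_; proj₁; proj₂)
open import Data.Sum using (_⊎_; inj₁; inj₂)
open import Data.Vec using (Vec; []; _∷_; lookup; tabulate)
open import Data.Vec.Properties using (lookup∘tabulate; tabulate∘lookup; tabulate-cong)
import Data.Vec.Properties as Vec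
open import Function using (_∘_; id; mk⇔)
open import Relation.Binary using (DecidableEquality; tri<; tri≈; tri>)
open import Relation.Binary.PropositionalEquality
open import Relation.Nullary using (Dec; yes; no; does)
open import Relation.Nullary.Decidable using (map′)
open import Relation.Unary using (Pred; Decidable)

module ListSum {c ℓ} (M : CommutativeMonoid c ℓ) where

  open CommutativeMonoid M renaming (refl to ≈-refl; sym to ≈-sym; trans to ≈-trans)
  open import Algebra.Properties.CommutativeSemigroup commutativeSemigroup using (interchange)

  ∑ : {A : Set} → List A → (A → Carrier) → Carrier
  ∑ xs f = foldr _∙_ ε (map f xs)

  ∑-cong-∈ : ∀ {A : Set} (xs : List A) {f g : A → Carrier} → (∀ {x} → x ∈ xs → f x ≈ g x) → ∑ xs f ≈ ∑ xs g
  ∑-cong-∈ []       f≈g = ≈-refl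
  ∑-cong-∈ (x ∷ xs) f≈g = ∙-cong (f≈g (here refl)) (∑-cong-∈ xs (f≈g ∘ there))

  ∑-cong : ∀ {A : Set} (xs : List A) {f g : A → Carrier} → (∀ x → f x ≈ g x) → ∑ xs f ≈ ∑ xs g
  ∑-cong xs f≈g = ∑-cong-∈ xs (λ {x} _ → f≈g x)

  ∑-ε : ∀ {A : Set} (xs : List A) → ∑ xs (λ _ → ε) ≈ ε
  ∑-ε []       = ≈-refl
  ∑-ε (x ∷ xs) = ≈-trans (identityˡ _) (∑-ε xs)

  ∑-∙ : ∀ {A : Set} (xs : List A) (f g : A → Carrier) → ∑ xs (λ x → f x ∙ g x) ≈ ∑ xs f ∙ ∑ xs g
  ∑-∙ []       f g = ≈-sym (identityˡ ε)
  ∑-∙ (x ∷ xs) f g = ≈-trans (∙-congˡ (∑-∙ xs f g)) (interchange _ _ _ _)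

  ∑-++ : ∀ {A : Set} (xs ys : List A) (f : A → Carrier) → ∑ (xs ++ ys) f ≈ ∑ xs f ∙ ∑ ys f
  ∑-++ []       ys f = ≈-sym (identityˡ _)
  ∑-++ (x ∷ xs) ys f = ≈-trans (∙-congˡ (∑-++ xs ys f)) (≈-sym (assoc _ _ _))

  ∑-filter : ∀ {A : Set} {p} {P : Pred A p} (P? : Decidable P) (xs : List A) (f : A → Carrier) →
             ∑ (filter P? xs) f ≈ ∑ xs (λ x → if does (P? x) then f x else ε)
  ∑-filter P? []       f = ≈-refl
  ∑-filter P? (x ∷ xs) f with does (P? x)
  ... | true  = ∙-congˡ (∑-filter P? xs f)
  ... | false = ≈-trans (∑-filter P? xs f) (≈-sym (identityˡ _))

  ∑-comm : ∀ {A B : Set} (xs : List A) (ys : List B) (f : A → B → Carrier) →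
           ∑ xs (λ x → ∑ ys (f x)) ≈ ∑ ys (λ y → ∑ xs (λ x → f x y))
  ∑-comm []       ys f = ≈-sym (∑-ε ys)
  ∑-comm (x ∷ xs) ys f = ≈-trans (∙-congˡ (∑-comm xs ys f)) (≈-sym (∑-∙ ys (f x) _))

  ∑-map : ∀ {A B : Set} (h : A → B) (xs : List A) (f : B → Carrier) → ∑ (map h xs) f ≡ ∑ xs (f ∘ h)
  ∑-map h xs f = cong (foldr _∙_ ε) (sym (map-∘ xs))

  ∑-cartesianProductWith : ∀ {A B D : Set} (h : A → B → D) (xs : List A) (ys : List B) (f : D → Carrier) →
                           ∑ (cartesianProductWith h xs ys) f ≈ ∑ xs (λ x → ∑ ys (f ∘ h x))
  ∑-cartesianProductWith h []       ys f = ≈-refl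
  ∑-cartesianProductWith h (x ∷ xs) ys f =
    ≈-trans (∑-++ (map (h x) ys) _ f) (∙-cong (reflexive (∑-map (h x) ys f)) (∑-cartesianProductWith h xs ys f))

  ∑-allFin-suc : ∀ {m} (f : Fin (suc m) → Carrier) → ∑ (allFin (suc m)) f ≡ f zero ∙ ∑ (allFin m) (f ∘ suc)
  ∑-allFin-suc f = cong (λ ys → f zero ∙ foldr _∙_ ε ys) (trans (map-tabulate suc f) (sym (map-tabulate id (f ∘ suc))))

module SemiringListSum {c ℓ} (R : CommutativeSemiring c ℓ) where

  open CommutativeSemiring R renaming (refl to ≈-refl; sym to ≈-sym; trans to ≈-trans)
  open ListSum +-commutativeMonoid public

  ∑-*ˡ : ∀ {A : Set} a (xs : List A) (f : A → Carrier) → a * ∑ xs f ≈ ∑ xs (λ x → a * f x)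
  ∑-*ˡ a []       f = zeroʳ a
  ∑-*ˡ a (x ∷ xs) f = ≈-trans (distribˡ a _ _) (+-congˡ (∑-*ˡ a xs f))

  ∑-*ʳ : ∀ {A : Set} a (xs : List A) (f : A → Carrier) → ∑ xs f * a ≈ ∑ xs (λ x → f x * a)
  ∑-*ʳ a xs f = ≈-trans (*-comm _ a) (≈-trans (∑-*ˡ a xs f) (∑-cong xs (λ x → *-comm a (f x))))

open SemiringListSum ℕ.+-*-commutativeSemiring
open ListSum ℕ.*-1-commutativeMonoid using ()
  renaming (∑ to ∏; ∑-cong to ∏-cong; ∑-∙ to ∏-*; ∑-filter to ∏-filter; ∑-allFin-suc to ∏-allFin-suc)
module ℤ∑ = SemiringListSum ℤ.+-*-commutativeSemiring

module Indicators where

  open import Data.Nat using (_*_; _^_)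
  open import Relation.Nullary using (¬_; _×-dec_)
  open import Relation.Nullary.Decidable using (does-⇔; dec-true; dec-false)
  open import Function using (_⇔_)

  χ : ∀ {p} {P : Set p} → Dec P → ℕ
  χ P? = if does P? then 1 else 0

  χ-cong : ∀ {p q} {P : Set p} {Q : Set q} (P? : Dec P) (Q? : Dec Q) → P ⇔ Q → χ P? ≡ χ Q?
  χ-cong P? Q? P⇔Q = cong (λ b → if b then 1 else 0) (does-⇔ P⇔Q P? Q?)

  χ-yes : ∀ {p} {P : Set p} (P? : Dec P) → P → χ P? ≡ 1
  χ-yes P? p = cong (λ b → if b then 1 else 0) (dec-true P? p)

  χ-no : ∀ {p} {P : Set p} (P? : Dec P) → ¬ P → χ P? ≡ 0
  χ-no P? ¬p = cong (λ b → if b then 1 else 0) (dec-false P? ¬p)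

  χ-× : ∀ {p q} {P : Set p} {Q : Set q} (P? : Dec P) (Q? : Dec Q) → χ (P? ×-dec Q?) ≡ χ P? * χ Q?
  χ-× (yes _) (yes _) = refl
  χ-× (yes _) (no _)  = refl
  χ-× (no _)  _       = refl

  χ-subst : ∀ {A : Set} {a v : A} (a≟v : Dec (a ≡ v)) (f : A → ℕ) → χ a≟v * f a ≡ χ a≟v * f v
  χ-subst (yes refl) f = refl
  χ-subst (no _)     f = refl

  length-filter≡∑χ : ∀ {A : Set} {p} {P : Pred A p} (P? : Decidable P) (xs : List A) →
                     length (filter P? xs) ≡ ∑ xs (χ ∘ P?)
  length-filter≡∑χ P? []       = refl
  length-filter≡∑χ P? (x ∷ xs) with does (P? x)
  ... | true  = cong suc (length-filter≡∑χ P? xs)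
  ... | false = length-filter≡∑χ P? xs

  ∏-if≡^∑χ : ∀ {A : Set} {p} {P : Pred A p} (P? : Decidable P) (xs : List A) a →
             ∏ xs (λ x → if does (P? x) then a else 1) ≡ a ^ ∑ xs (χ ∘ P?)
  ∏-if≡^∑χ P? []       a = refl
  ∏-if≡^∑χ P? (x ∷ xs) a with does (P? x)
  ... | true  = cong (a *_) (∏-if≡^∑χ P? xs a)
  ... | false = trans (ℕ.+-identityʳ _) (∏-if≡^∑χ P? xs a)

open Indicators

module Subsets where

  open import Data.Nat using (_+_; _*_; s≤s; z≤n)
  open import Data.Nat.Combinatorics using (_C_; nCk+nC[k+1]≡[n+1]C[k+1]; k>n⇒nCk≡0)
  open import Data.Fin.Subset using (inside; outside)
  open import Data.List using (upTo)
  open import Data.List.Properties using (map-applyUpTo)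
  open import Data.List.Membership.Propositional.Properties using (∈-cartesianProductWith⁺)
  open import Data.List.Relation.Unary.AllPairs using ([]; _∷_)
  open import Algebra.Properties.CommutativeSemigroup ℕ.+-commutativeSemigroup using (x∙yz≈y∙xz)

  ∑-upTo-suc : ∀ n (f : ℕ → ℕ) → ∑ (upTo (suc n)) f ≡ f 0 + ∑ (upTo n) (f ∘ suc)
  ∑-upTo-suc n f = cong (f 0 +_) (trans (cong (λ js → ∑ js f) (sym (map-applyUpTo id suc n))) (∑-map suc (upTo n) f))

  vectors : ∀ {A : Set} → List A → (n : ℕ) → List (Vec A n)
  vectors xs zero    = [] ∷ []
  vectors xs (suc n) = cartesianProductWith _∷_ xs (vectors xs n)

  vectors-unique : ∀ {A : Set} {xs : List A} n → Unique xs → Unique (vectors xs n)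
  vectors-unique zero    _   = All.[] ∷ []
  vectors-unique (suc n) !xs = Unique.cartesianProductWith⁺ _∷_ Vec.∷-injective !xs (vectors-unique n !xs)

  ∈-vectors : ∀ {A : Set} {xs : List A} → (∀ x → x ∈ xs) → ∀ {n} (v : Vec A n) → v ∈ vectors xs n
  ∈-vectors ∈xs []      = here refl
  ∈-vectors ∈xs (x ∷ v) = ∈-cartesianProductWith⁺ _∷_ (∈xs x) (∈-vectors ∈xs v)

  subsets : (k : ℕ) → List (Subset k)
  subsets = vectors (inside ∷ outside ∷ [])

  subsets-unique : ∀ k → Unique (subsets k)
  subsets-unique k = vectors-unique k (((λ ()) All.∷ All.[]) ∷ All.[] ∷ [])

  ∈-subsets : ∀ {k} (s : Subset k) → s ∈ subsets k
  ∈-subsets = ∈-vectors λ { inside → here refl ; outside → there (here refl) }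

  ∑-subsets : ∀ {k} (f : Subset (suc k) → ℕ) →
              ∑ (subsets (suc k)) f ≡ ∑ (subsets k) (f ∘ (inside ∷_)) + ∑ (subsets k) (f ∘ (outside ∷_))
  ∑-subsets {k} f = trans (∑-cartesianProductWith _∷_ (inside ∷ outside ∷ []) (subsets k) f)
                          (cong (∑ (subsets k) (f ∘ (inside ∷_)) +_) (ℕ.+-identityʳ _))

  -- Any range N > k will do since k C j = 0 for j > k; allowing every such N lets the induction
  -- use the hypothesis at both N - 1 and N without ever extending a range.
  ∑-subsets-by-size : ∀ k {N} → k < N → (F : ℕ → ℕ) →
                      ∑ (subsets k) (F ∘ ∣_∣) ≡ ∑ (upTo N) (λ j → (k C j) * F j)
  ∑-subsets-by-size zero {suc N} _ F = sym (begin
      ∑ (upTo (suc N)) (λ j → (0 C j) * F j)                       ≡⟨ ∑-upTo-suc N _ ⟩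
      (0 C 0) * F 0 + ∑ (upTo N) (λ j → (0 C suc j) * F (suc j))   ≡⟨ cong ((0 C 0) * F 0 +_) (∑-cong (upTo N) vanish) ⟩
      (0 C 0) * F 0 + ∑ (upTo N) (λ _ → 0)                         ≡⟨ cong ((0 C 0) * F 0 +_) (∑-ε (upTo N)) ⟩
      (0 C 0) * F 0 + 0                                            ≡⟨ ℕ.+-identityʳ _ ⟩
      (0 C 0) * F 0                                                ∎)
    where
      open ≡-Reasoning
      vanish : ∀ j → (0 C suc j) * F (suc j) ≡ 0
      vanish j = cong (_* F (suc j)) (k>n⇒nCk≡0 {0} {suc j} (s≤s z≤n))
  ∑-subsets-by-size (suc k) {suc N} (s≤s k<N) F = begin
      ∑ (subsets (suc k)) (F ∘ ∣_∣)                               ≡⟨ ∑-subsets {k} (F ∘ ∣_∣) ⟩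
      ∑ (subsets k) (F ∘ suc ∘ ∣_∣) + ∑ (subsets k) (F ∘ ∣_∣)     ≡⟨ cong₂ _+_ (∑-subsets-by-size k k<N (F ∘ suc))
                                                                       (∑-subsets-by-size k (ℕ.m<n⇒m<1+n k<N) F) ⟩
      X + ∑ (upTo (suc N)) (λ j → (k C j) * F j)                  ≡⟨ cong (X +_) (∑-upTo-suc N _) ⟩
      X + ((k C 0) * F 0 + Z)                                     ≡⟨ x∙yz≈y∙xz X ((k C 0) * F 0) Z ⟩
      (k C 0) * F 0 + (X + Z)                                     ≡⟨ cong ((k C 0) * F 0 +_) (∑-∙ (upTo N) _ _) ⟨
      (k C 0) * F 0 + ∑ (upTo N) (λ j → (k C j) * F (suc j) + (k C suc j) * F (suc j))
                                                                  ≡⟨ cong ((k C 0) * F 0 +_) (∑-cong (upTo N) pascal) ⟩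
      (suc k C 0) * F 0 + ∑ (upTo N) (λ j → (suc k C suc j) * F (suc j))
                                                                  ≡⟨ ∑-upTo-suc N _ ⟨
      ∑ (upTo (suc N)) (λ j → (suc k C j) * F j)                  ∎
    where
      open ≡-Reasoning
      X Z : ℕ
      X = ∑ (upTo N) (λ j → (k C j) * F (suc j))
      Z = ∑ (upTo N) (λ j → (k C suc j) * F (suc j))
      pascal : ∀ j → (k C j) * F (suc j) + (k C suc j) * F (suc j) ≡ (suc k C suc j) * F (suc j)
      pascal j = trans (sym (ℕ.*-distribʳ-+ (F (suc j)) (k C j) _)) (cong (_* F (suc j)) (nCk+nC[k+1]≡[n+1]C[k+1] k j))

  ∑-subsets-of-size : ∀ k v → ∑ (subsets k) (λ s → χ (∣ s ∣ ℕ.≟ v)) ≡ k C v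
  ∑-subsets-of-size zero    zero    = refl
  ∑-subsets-of-size zero    (suc v) = sym (k>n⇒nCk≡0 {0} {suc v} (s≤s z≤n))
  ∑-subsets-of-size (suc k) zero    =
    trans (∑-subsets {k} (λ s → χ (∣ s ∣ ℕ.≟ 0))) (cong₂ _+_ (∑-ε (subsets k)) (∑-subsets-of-size k zero))
  ∑-subsets-of-size (suc k) (suc v) =
    trans (∑-subsets {k} (λ s → χ (∣ s ∣ ℕ.≟ suc v)))
          (trans (cong₂ _+_ (∑-subsets-of-size k v) (∑-subsets-of-size k (suc v))) (nCk+nC[k+1]≡[n+1]C[k+1] k v))

open Subsets

-- Constraints on the sizes of the entries of c : Vec (Subset k) m: each position is tied to a root
-- position (inj₁) or has a prescribed size (inj₂). Prescribed sizes appear when the induction on m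
-- fixes the size of position 0 and removes it.
module SizeConstraints (k : ℕ) where

  open import Data.Nat using (_+_; _*_; _^_)
  open import Data.Nat.Combinatorics using (_C_)
  import Data.Sum.Properties as Sum
  open import Data.List using (upTo)
  open import Function using (_⇔_; mk⇔; case_of_)
  open import Relation.Nullary using (_×-dec_)

  Target : ℕ → Set
  Target m = Fin m ⊎ ℕ

  Constraints : ℕ → Set
  Constraints m = Fin m → Target m

  _≟ᵗ_ : ∀ {m} → DecidableEquality (Target m)
  _≟ᵗ_ = Sum.≡-dec _≟_ ℕ._≟_

  sizeOf : ∀ {m} → Target m → Vec (Subset k) m → ℕ
  sizeOf (inj₁ j) c = ∣ lookup c j ∣
  sizeOf (inj₂ v) c = v

  Satisfies : ∀ {m} → Constraints m → Vec (Subset k) m → Set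
  Satisfies ρ c = ∀ i → ∣ lookup c i ∣ ≡ sizeOf (ρ i) c

  satisfies? : ∀ {m} (ρ : Constraints m) c → Dec (Satisfies ρ c)
  satisfies? ρ c = all? (λ i → ∣ lookup c i ∣ ℕ.≟ sizeOf (ρ i) c)

  solutions : ∀ {m} → Constraints m → ℕ
  solutions {m} ρ = ∑ (vectors (subsets k) m) (χ ∘ satisfies? ρ)

  Rooted : ∀ {m} → Constraints m → Set
  Rooted ρ = ∀ i j → ρ i ≡ inj₁ j → toℕ j ≤ toℕ i × ρ j ≡ inj₁ j

  tiedTo : ∀ {m} → Constraints m → Fin m → ℕ
  tiedTo {m} ρ r = ∑ (allFin m) (λ i → χ (ρ i ≟ᵗ inj₁ r))

  weightAt : ∀ {m} → Constraints m → Fin m → Target m → ℕ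
  weightAt ρ i (inj₁ j) = if does (j ≟ i) then Fr k (tiedTo ρ i) else 1
  weightAt ρ i (inj₂ v) = k C v

  weight : ∀ {m} → Constraints m → Fin m → ℕ
  weight ρ i = weightAt ρ i (ρ i)

  retarget : ∀ {m} → ℕ → Target (suc m) → Target m
  retarget x (inj₁ zero)    = inj₂ x
  retarget x (inj₁ (suc j)) = inj₁ j
  retarget x (inj₂ v)       = inj₂ v

  tailGiven : ∀ {m} → ℕ → Constraints (suc m) → Constraints m
  tailGiven x ρ = retarget x ∘ ρ ∘ suc

  tiedToHead : ∀ {m} → Constraints (suc m) → ℕ
  tiedToHead {m} ρ = ∑ (allFin m) (λ i → χ (ρ (suc i) ≟ᵗ inj₁ zero))

  sizeOf-retarget : ∀ {m} (t : Target (suc m)) s c → sizeOf t (s ∷ c) ≡ sizeOf (retarget ∣ s ∣ t) c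
  sizeOf-retarget (inj₁ zero)    s c = refl
  sizeOf-retarget (inj₁ (suc j)) s c = refl
  sizeOf-retarget (inj₂ v)       s c = refl

  satisfies-∷ : ∀ {m} (ρ : Constraints (suc m)) s c →
                Satisfies ρ (s ∷ c) ⇔ (∣ s ∣ ≡ sizeOf (ρ zero) (s ∷ c) × Satisfies (tailGiven ∣ s ∣ ρ) c)
  satisfies-∷ ρ s c = mk⇔
    (λ sat → sat zero , λ i → trans (sat (suc i)) (sizeOf-retarget (ρ (suc i)) s c))
    (λ { (head , tail) zero    → head
       ; (head , tail) (suc i) → trans (tail i) (sym (sizeOf-retarget (ρ (suc i)) s c)) })

  solutions-suc : ∀ {m} (ρ : Constraints (suc m)) → solutions ρ ≡
    ∑ (subsets k) (λ s → ∑ (vectors (subsets k) m) (λ c →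
      χ (∣ s ∣ ℕ.≟ sizeOf (ρ zero) (s ∷ c)) * χ (satisfies? (tailGiven ∣ s ∣ ρ) c)))
  solutions-suc {m} ρ = trans (∑-cartesianProductWith _∷_ (subsets k) (vectors (subsets k) m) _)
    (∑-cong (subsets k) λ s → ∑-cong (vectors (subsets k) m) λ c →
      trans (χ-cong (satisfies? ρ (s ∷ c)) (head? s c ×-dec satisfies? (tailGiven ∣ s ∣ ρ) c) (satisfies-∷ ρ s c))
            (χ-× (head? s c) (satisfies? (tailGiven ∣ s ∣ ρ) c)))
    where
      head? : ∀ s c → Dec (∣ s ∣ ≡ sizeOf (ρ zero) (s ∷ c))
      head? s c = ∣ s ∣ ℕ.≟ sizeOf (ρ zero) (s ∷ c)

  retarget-inj₁ : ∀ {m} {x j} (t : Target (suc m)) → retarget x t ≡ inj₁ j → t ≡ inj₁ (suc j)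
  retarget-inj₁ (inj₁ (suc j)) refl = refl

  tailGiven-rooted : ∀ {m} (ρ : Constraints (suc m)) x → Rooted ρ → Rooted (tailGiven x ρ)
  tailGiven-rooted ρ x rooted i j tied with rooted (suc i) (suc j) (retarget-inj₁ (ρ (suc i)) tied)
  ... | 1+j≤1+i , ρ[1+j] = ℕ.≤-pred 1+j≤1+i , cong (retarget x) ρ[1+j]

  retarget-tied : ∀ {m} x (t : Target (suc m)) r → χ (retarget x t ≟ᵗ inj₁ r) ≡ χ (t ≟ᵗ inj₁ (suc r))
  retarget-tied x (inj₁ zero)    r = refl
  retarget-tied x (inj₁ (suc j)) r = refl
  retarget-tied x (inj₂ v)       r = refl

  tiedTo-tailGiven : ∀ {m} (ρ : Constraints (suc m)) x → Rooted ρ → ∀ r →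
                     tiedTo (tailGiven x ρ) r ≡ tiedTo ρ (suc r)
  tiedTo-tailGiven {m} ρ x rooted r = begin
    tiedTo (tailGiven x ρ) r
      ≡⟨ ∑-cong (allFin m) (λ i → retarget-tied x (ρ (suc i)) r) ⟩
    ∑ (allFin m) (λ i → χ (ρ (suc i) ≟ᵗ inj₁ (suc r)))
      ≡⟨ cong (_+ ∑ (allFin m) (λ i → χ (ρ (suc i) ≟ᵗ inj₁ (suc r)))) (χ-no (ρ zero ≟ᵗ inj₁ (suc r)) head-untied) ⟨
    χ (ρ zero ≟ᵗ inj₁ (suc r)) + ∑ (allFin m) (λ i → χ (ρ (suc i) ≟ᵗ inj₁ (suc r)))
      ≡⟨ ∑-allFin-suc (λ i → χ (ρ i ≟ᵗ inj₁ (suc r))) ⟨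
    tiedTo ρ (suc r) ∎
    where
      open ≡-Reasoning
      head-untied : ρ zero ≢ inj₁ (suc r)
      head-untied tied with () ← proj₁ (rooted zero (suc r) tied)

  weight-tailGiven : ∀ {m} (ρ : Constraints (suc m)) x → Rooted ρ → ∀ r →
    weight (tailGiven x ρ) r ≡ (if does (ρ (suc r) ≟ᵗ inj₁ zero) then k C x else 1) * weight ρ (suc r)
  weight-tailGiven ρ x rooted r with ρ (suc r)
  ... | inj₁ zero    = sym (ℕ.*-identityʳ (k C x))
  ... | inj₁ (suc j) = trans (cong (λ n → if does (j ≟ r) then Fr k n else 1) (tiedTo-tailGiven ρ x rooted r))
                             (sym (ℕ.+-identityʳ _))
  ... | inj₂ v       = sym (ℕ.+-identityʳ (k C v))

  ∏-weight-tailGiven : ∀ {m} (ρ : Constraints (suc m)) x → Rooted ρ →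
    ∏ (allFin m) (weight (tailGiven x ρ)) ≡ (k C x) ^ tiedToHead ρ * ∏ (allFin m) (weight ρ ∘ suc)
  ∏-weight-tailGiven {m} ρ x rooted = begin
    ∏ (allFin m) (weight (tailGiven x ρ))
      ≡⟨ ∏-cong (allFin m) (weight-tailGiven ρ x rooted) ⟩
    ∏ (allFin m) (λ r → headFactor r * weight ρ (suc r))
      ≡⟨ ∏-* (allFin m) headFactor (weight ρ ∘ suc) ⟩
    ∏ (allFin m) headFactor * ∏ (allFin m) (weight ρ ∘ suc)
      ≡⟨ cong (_* ∏ (allFin m) (weight ρ ∘ suc)) (∏-if≡^∑χ (λ r → ρ (suc r) ≟ᵗ inj₁ zero) (allFin m) (k C x)) ⟩
    (k C x) ^ tiedToHead ρ * ∏ (allFin m) (weight ρ ∘ suc) ∎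
    where
      open ≡-Reasoning
      headFactor : Fin m → ℕ
      headFactor r = if does (ρ (suc r) ≟ᵗ inj₁ zero) then k C x else 1

  solutions-headRoot : ∀ {m} (ρ : Constraints (suc m)) → Rooted ρ → ρ zero ≡ inj₁ zero →
    (∀ x → solutions (tailGiven x ρ) ≡ ∏ (allFin m) (weight (tailGiven x ρ))) →
    solutions ρ ≡ ∏ (allFin (suc m)) (weight ρ)
  solutions-headRoot {m} ρ rooted head tail-solutions = begin
    solutions ρ
      ≡⟨ solutions-suc ρ ⟩
    ∑ (subsets k) (λ s → ∑ (vectors (subsets k) m) (λ c →
      χ (∣ s ∣ ℕ.≟ sizeOf (ρ zero) (s ∷ c)) * χ (satisfies? (tailGiven ∣ s ∣ ρ) c)))
      ≡⟨ ∑-cong (subsets k) (λ s → ∑-cong (vectors (subsets k) m) λ c →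
           trans (cong (_* χ (satisfies? (tailGiven ∣ s ∣ ρ) c)) (head-satisfied s c)) (ℕ.+-identityʳ _)) ⟩
    ∑ (subsets k) (λ s → solutions (tailGiven ∣ s ∣ ρ))
      ≡⟨ ∑-cong (subsets k) (λ s → trans (tail-solutions ∣ s ∣) (∏-weight-tailGiven ρ ∣ s ∣ rooted)) ⟩
    ∑ (subsets k) (λ s → (k C ∣ s ∣) ^ b * T)
      ≡⟨ ∑-subsets-by-size k ℕ.≤-refl (λ j → (k C j) ^ b * T) ⟩
    ∑ (upTo (suc k)) (λ j → (k C j) * ((k C j) ^ b * T))
      ≡⟨ ∑-cong (upTo (suc k)) (λ j → sym (ℕ.*-assoc (k C j) _ T)) ⟩
    ∑ (upTo (suc k)) (λ j → (k C j) ^ suc b * T)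
      ≡⟨ ∑-*ʳ T (upTo (suc k)) (λ j → (k C j) ^ suc b) ⟨
    Fr k (suc b) * T
      ≡⟨ cong (_* T) head-weight ⟨
    weight ρ zero * T
      ≡⟨ ∏-allFin-suc (weight ρ) ⟨
    ∏ (allFin (suc m)) (weight ρ) ∎
    where
      open ≡-Reasoning
      b T : ℕ
      b = tiedToHead ρ
      T = ∏ (allFin m) (weight ρ ∘ suc)
      head-satisfied : ∀ s c → χ (∣ s ∣ ℕ.≟ sizeOf (ρ zero) (s ∷ c)) ≡ 1
      head-satisfied s c = χ-yes (∣ s ∣ ℕ.≟ sizeOf (ρ zero) (s ∷ c)) (cong (λ t → sizeOf t (s ∷ c)) (sym head))
      head-weight : weight ρ zero ≡ Fr k (suc b)
      head-weight = trans (cong (weightAt ρ zero) head) (cong (Fr k)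
        (trans (∑-allFin-suc (λ i → χ (ρ i ≟ᵗ inj₁ zero)))
               (cong (_+ b) (χ-yes (ρ zero ≟ᵗ inj₁ zero) head))))

  solutions-headFixed : ∀ {m} (ρ : Constraints (suc m)) v → Rooted ρ → ρ zero ≡ inj₂ v →
    solutions (tailGiven v ρ) ≡ ∏ (allFin m) (weight (tailGiven v ρ)) →
    solutions ρ ≡ ∏ (allFin (suc m)) (weight ρ)
  solutions-headFixed {m} ρ v rooted head tail-solutions = begin
    solutions ρ
      ≡⟨ solutions-suc ρ ⟩
    ∑ (subsets k) (λ s → ∑ (vectors (subsets k) m) (λ c →
      χ (∣ s ∣ ℕ.≟ sizeOf (ρ zero) (s ∷ c)) * χ (satisfies? (tailGiven ∣ s ∣ ρ) c)))
      ≡⟨ ∑-cong (subsets k) (λ s → ∑-cong (vectors (subsets k) m) λ c →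
           cong (λ t → χ (∣ s ∣ ℕ.≟ sizeOf t (s ∷ c)) * χ (satisfies? (tailGiven ∣ s ∣ ρ) c)) head) ⟩
    ∑ (subsets k) (λ s → ∑ (vectors (subsets k) m) (λ c → χ (∣ s ∣ ℕ.≟ v) * χ (satisfies? (tailGiven ∣ s ∣ ρ) c)))
      ≡⟨ ∑-cong (subsets k) (λ s → ∑-*ˡ (χ (∣ s ∣ ℕ.≟ v)) (vectors (subsets k) m) _) ⟨
    ∑ (subsets k) (λ s → χ (∣ s ∣ ℕ.≟ v) * solutions (tailGiven ∣ s ∣ ρ))
      ≡⟨ ∑-cong (subsets k) (λ s → χ-subst (∣ s ∣ ℕ.≟ v) (λ x → solutions (tailGiven x ρ))) ⟩
    ∑ (subsets k) (λ s → χ (∣ s ∣ ℕ.≟ v) * solutions (tailGiven v ρ))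
      ≡⟨ ∑-*ʳ (solutions (tailGiven v ρ)) (subsets k) (λ s → χ (∣ s ∣ ℕ.≟ v)) ⟨
    ∑ (subsets k) (λ s → χ (∣ s ∣ ℕ.≟ v)) * solutions (tailGiven v ρ)
      ≡⟨ cong₂ _*_ (∑-subsets-of-size k v) (trans tail-solutions (∏-weight-tailGiven ρ v rooted)) ⟩
    (k C v) * ((k C v) ^ tiedToHead ρ * T)
      ≡⟨ cong (λ e → (k C v) * ((k C v) ^ e * T)) head-untied ⟩
    (k C v) * (1 * T)
      ≡⟨ cong₂ _*_ (cong (weightAt ρ zero) (sym head)) (ℕ.*-identityˡ T) ⟩
    weight ρ zero * T
      ≡⟨ ∏-allFin-suc (weight ρ) ⟨
    ∏ (allFin (suc m)) (weight ρ) ∎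
    where
      open ≡-Reasoning
      T : ℕ
      T = ∏ (allFin m) (weight ρ ∘ suc)
      head-untied : tiedToHead ρ ≡ 0
      head-untied = trans (∑-cong (allFin m) λ i → χ-no (ρ (suc i) ≟ᵗ inj₁ zero) λ tied →
                             case trans (sym head) (proj₂ (rooted (suc i) zero tied)) of λ ())
                          (∑-ε (allFin m))

  solutions≡∏weight : ∀ m (ρ : Constraints m) → Rooted ρ → solutions ρ ≡ ∏ (allFin m) (weight ρ)
  solutions≡∏weight zero    ρ rooted = refl
  solutions≡∏weight (suc m) ρ rooted = byHead (ρ zero) refl
    where
      byHead : ∀ t → ρ zero ≡ t → solutions ρ ≡ ∏ (allFin (suc m)) (weight ρ)
      byHead (inj₁ zero)    head = solutions-headRoot ρ rooted head λ x →
                                     solutions≡∏weight m (tailGiven x ρ) (tailGiven-rooted ρ x rooted)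
      byHead (inj₁ (suc j)) head with () ← proj₁ (rooted zero (suc j) head)
      byHead (inj₂ v)       head = solutions-headFixed ρ v rooted head
                                     (solutions≡∏weight m (tailGiven v ρ) (tailGiven-rooted ρ v rooted))

  partitionConstraints : ∀ {n} → PartRep n → Constraints n
  partitionConstraints π i = inj₁ (lookup π i)

  partitionConstraints-rooted : ∀ {n} (π : PartRep n) → IsPartition π → Rooted (partitionConstraints π)
  partitionConstraints-rooted π isPart i j refl = proj₁ (isPart i) , cong inj₁ (proj₂ (isPart i))

  solutions-partition : ∀ {n} (π : PartRep n) → IsPartition π → solutions (partitionConstraints π) ≡ blockProduct k π
  solutions-partition {n} π isPart = begin
    solutions (partitionConstraints π)
      ≡⟨ solutions≡∏weight n (partitionConstraints π) (partitionConstraints-rooted π isPart) ⟩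
    ∏ (allFin n) (weight (partitionConstraints π))
      ≡⟨ ∏-cong (allFin n) (λ r → cong (λ b → if does (lookup π r ≟ r) then Fr k b else 1)
           (sym (length-filter≡∑χ (λ i → lookup π i ≟ r) (allFin n)))) ⟩
    ∏ (allFin n) (λ r → if does (lookup π r ≟ r) then Fr k (blockSize π r) else 1)
      ≡⟨ ∏-filter (λ r → lookup π r ≟ r) (allFin n) (Fr k ∘ blockSize π) ⟨
    blockProduct k π ∎
    where open ≡-Reasoning

∑-mono-≤ : ∀ {A : Set} (xs : List A) {f g : A → ℕ} → (∀ x → f x ≤ g x) → ∑ xs f ≤ ∑ xs g
∑-mono-≤ []       f≤g = ℕ.≤-refl
∑-mono-≤ (x ∷ xs) f≤g = ℕ.+-mono-≤ (f≤g x) (∑-mono-≤ xs f≤g)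

∑-mono-< : ∀ {A : Set} {xs : List A} {f g : A → ℕ} → (∀ x → f x ≤ g x) →
           ∀ {y} → y ∈ xs → f y < g y → ∑ xs f < ∑ xs g
∑-mono-< {xs = x ∷ xs} f≤g (here refl) fy<gy = ℕ.+-mono-<-≤ fy<gy (∑-mono-≤ xs f≤g)
∑-mono-< {xs = x ∷ xs} f≤g (there y∈) fy<gy = ℕ.+-mono-≤-< (f≤g x) (∑-mono-< f≤g y∈ fy<gy)

module Walks {n} (G : SimpleGraph n) where

  walk-head : ∀ {P : Fin n → Set} {x y} → WalkIn G P x y → P x
  walk-head (nil px)      = px
  walk-head (cons px _ _) = px

  walk-map : ∀ {P Q : Fin n → Set} {x y} → (∀ {w} → P w → Q w) → WalkIn G P x y → WalkIn G Q x y
  walk-map P⇒Q (nil px)       = nil (P⇒Q px)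
  walk-map P⇒Q (cons px xy w) = cons (P⇒Q px) xy (walk-map P⇒Q w)

  walk-bridge : ∀ {P : Fin n → Set} {x u v y} → WalkIn G P x u → Adj G u v → WalkIn G P v y → WalkIn G P x y
  walk-bridge (nil px)        uv w = cons px uv w
  walk-bridge (cons px xz w′) uv w = cons px xz (walk-bridge w′ uv w)

  walk-firstStep : ∀ {P : Fin n → Set} {x y} → WalkIn G P x y → x ≢ y → Σ[ z ∈ Fin n ] Adj G x z × P z
  walk-firstStep (nil _)       x≢x = ⊥-elim (x≢x refl)
  walk-firstStep (cons _ xz w) _   = _ , xz , walk-head w

  walk-crossing : ∀ {B : Set} (_≟ᴮ_ : DecidableEquality B) (h : Fin n → B) {P : Fin n → Set} {x y} →
                  WalkIn G P x y → h x ≢ h y →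
                  Σ[ u ∈ Fin n ] Σ[ v ∈ Fin n ] P u × P v × Adj G u v × h u ≢ h v
  walk-crossing _≟ᴮ_ h (nil _) hx≢hx = ⊥-elim (hx≢hx refl)
  walk-crossing _≟ᴮ_ h {x = x} (cons {j = z} px xz w) hx≢hy with h x ≟ᴮ h z
  ... | yes hx≡hz = walk-crossing _≟ᴮ_ h w (hx≢hy ∘ trans hx≡hz)
  ... | no  hx≢hz = x , z , px , walk-head w , xz , hx≢hz

  walk-coarsen : ∀ {σ τ : PartRep n} → Refines σ τ → ∀ {x y} →
                 WalkIn G (λ w → SameBlock σ w x) x y → WalkIn G (λ w → SameBlock τ w x) x y
  walk-coarsen σ≤τ = walk-map (σ≤τ _ _)

lookup-bottom : ∀ {n} (i : Fin n) → lookup bottom i ≡ i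
lookup-bottom = lookup∘tabulate id

sameBlock-bottom : ∀ {n} {i j : Fin n} → SameBlock bottom i j → i ≡ j
sameBlock-bottom {i = i} {j} i~j = trans (sym (lookup-bottom i)) (trans i~j (lookup-bottom j))

bottom-inΠ : ∀ {n} (G : SimpleGraph n) → InΠ G bottom
bottom-inΠ G = (λ i → ℕ.≤-reflexive (cong toℕ (lookup-bottom i)) , cong (lookup bottom) (lookup-bottom i))
             , λ i j i~j → subst (WalkIn G _ i) (sameBlock-bottom i~j) (nil refl)

repSum : ∀ {n} → PartRep n → ℕ
repSum {n} π = ∑ (allFin n) (toℕ ∘ lookup π)

ConstantOn : ∀ {n} {A : Set} → (Fin n → A) → PartRep n → Set
ConstantOn f π = ∀ i → f i ≡ f (lookup π i)

constantOn? : ∀ {n} {A : Set} → DecidableEquality A → (f : Fin n → A) → ∀ π → Dec (ConstantOn f π)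
constantOn? _≟ᴬ_ f π = all? (λ i → f i ≟ᴬ f (lookup π i))

Proper : ∀ {n} {A : Set} → SimpleGraph n → (Fin n → A) → Set
Proper G f = ∀ i j → Adj G i j → f i ≢ f j

module Merge {n} (π : PartRep n) (a b : Fin n) where

  relabel : Fin n → Fin n
  relabel r with r ≟ b
  ... | yes _ = a
  ... | no  _ = r

  merged : PartRep n
  merged = tabulate (relabel ∘ lookup π)

  lookup-merged : ∀ x → lookup merged x ≡ relabel (lookup π x)
  lookup-merged = lookup∘tabulate (relabel ∘ lookup π)

  relabel-cases : ∀ r → (r ≡ b × relabel r ≡ a) ⊎ (r ≢ b × relabel r ≡ r)
  relabel-cases r with r ≟ b
  ... | yes r≡b = inj₁ (r≡b , refl)
  ... | no  r≢b = inj₂ (r≢b , refl)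

  relabel-b : relabel b ≡ a
  relabel-b with relabel-cases b
  ... | inj₁ (_ , ba)  = ba
  ... | inj₂ (b≢b , _) = ⊥-elim (b≢b refl)

  relabel-≡ : ∀ {r s} → relabel r ≡ relabel s → r ≢ s → (r ≡ a × s ≡ b) ⊎ (r ≡ b × s ≡ a)
  relabel-≡ {r} {s} eq r≢s with relabel-cases r | relabel-cases s
  ... | inj₁ (r≡b , _)  | inj₁ (s≡b , _)  = ⊥-elim (r≢s (trans r≡b (sym s≡b)))
  ... | inj₁ (r≡b , ra) | inj₂ (_ , ss)   = inj₂ (r≡b , trans (sym ss) (trans (sym eq) ra))
  ... | inj₂ (_ , rr)   | inj₁ (s≡b , sa) = inj₁ (trans (sym rr) (trans eq sa) , s≡b)
  ... | inj₂ (_ , rr)   | inj₂ (_ , ss)   = ⊥-elim (r≢s (trans (sym rr) (trans eq ss)))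

  refines-merged : Refines π merged
  refines-merged x y πx≡πy = trans (lookup-merged x) (trans (cong relabel πx≡πy) (sym (lookup-merged y)))

  merged-constant : ∀ {A : Set} {f : Fin n → A} → ConstantOn f π → f a ≡ f b → ConstantOn f merged
  merged-constant {f = f} const fa≡fb x rewrite lookup-merged x with relabel-cases (lookup π x)
  ... | inj₁ (πx≡b , ra) rewrite ra = trans (const x) (trans (cong f πx≡b) (sym fa≡fb))
  ... | inj₂ (_ , rr)    rewrite rr = const x

  module _ (a<b : toℕ a < toℕ b) where

    relabel-≤ : ∀ r → toℕ (relabel r) ≤ toℕ r
    relabel-≤ r with relabel-cases r
    ... | inj₁ (refl , ra) rewrite ra = ℕ.<⇒≤ a<b
    ... | inj₂ (_ , rr)    rewrite rr = ℕ.≤-refl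

    relabel-a : relabel a ≡ a
    relabel-a with relabel-cases a
    ... | inj₁ (a≡b , _) = ⊥-elim (ℕ.<-irrefl (cong toℕ a≡b) a<b)
    ... | inj₂ (_ , aa)  = aa

    relabel-idempotent : lookup π a ≡ a → ∀ r → lookup π r ≡ r → relabel (lookup π (relabel r)) ≡ relabel r
    relabel-idempotent πa≡a r πr≡r with relabel-cases r
    ... | inj₁ (_ , ra) rewrite ra | πa≡a = relabel-a
    ... | inj₂ (_ , rr) rewrite rr | πr≡r = rr

    merged-isPartition : IsPartition π → lookup π a ≡ a → IsPartition merged
    merged-isPartition isPart πa≡a x rewrite lookup-merged x
      = ℕ.≤-trans (relabel-≤ (lookup π x)) (proj₁ (isPart x))
      , trans (lookup-merged _) (relabel-idempotent πa≡a (lookup π x) (proj₂ (isPart x)))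

    merged-repSum< : lookup π b ≡ b → repSum merged < repSum π
    merged-repSum< πb≡b = ∑-mono-< merged≤π (∈-allFin b) merged[b]<π[b]
      where
        merged≤π : ∀ x → toℕ (lookup merged x) ≤ toℕ (lookup π x)
        merged≤π x rewrite lookup-merged x = relabel-≤ (lookup π x)
        merged[b]<π[b] : toℕ (lookup merged b) < toℕ (lookup π b)
        merged[b]<π[b] rewrite lookup-merged b | πb≡b | relabel-b = a<b

  module _ (G : SimpleGraph n) where
    open Walks G

    walk-merged : ∀ {x y} → WalkIn G (λ w → SameBlock π w x) x y → WalkIn G (λ w → SameBlock merged w x) x y
    walk-merged = walk-coarsen {π} {merged} refines-merged

    walk-across : BlocksConnected G π → ∀ {x y u′ v′} → SameBlock merged x y →
                  SameBlock π x u′ → SameBlock π v′ y → Adj G u′ v′ → WalkIn G (λ w → SameBlock merged w x) x y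
    walk-across conn {x} {y} x~y x~u′ v′~y u′v′ = walk-bridge
      (walk-merged (conn x _ x~u′))
      u′v′
      (walk-map (λ w~v′ → trans w~v′ (trans (refines-merged _ _ v′~y) (sym x~y))) (walk-merged (conn _ y v′~y)))

    merged-connected : BlocksConnected G π → ∀ {u v} → Adj G u v → lookup π u ≡ a → lookup π v ≡ b →
                       BlocksConnected G merged
    merged-connected conn {u} {v} uv πu≡a πv≡b x y x~y with lookup π x ≟ lookup π y
    ... | yes πx≡πy = walk-merged (conn x y πx≡πy)
    ... | no  πx≢πy with relabel-≡ (trans (sym (lookup-merged x)) (trans x~y (lookup-merged y))) πx≢πy
    ...   | inj₁ (πx≡a , πy≡b) = walk-across conn x~y (trans πx≡a (sym πu≡a)) (trans πv≡b (sym πy≡b)) uv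
    ...   | inj₂ (πx≡b , πy≡a) = walk-across conn x~y (trans πx≡b (sym πv≡b)) (trans πu≡a (sym πy≡a)) (SimpleGraph.sym G uv)

module _ {n} (G : SimpleGraph n) {A : Set} (f : Fin n → A) where

  Improvement : PartRep n → Set
  Improvement π = Σ[ π′ ∈ PartRep n ] InΠ G π′ × ConstantOn f π′ × repSum π′ < repSum π

  merge-along : ∀ π {u v} → InΠ G π → ConstantOn f π → Adj G u v → f u ≡ f v →
                toℕ (lookup π u) < toℕ (lookup π v) → Improvement π
  merge-along π {u} {v} (isPart , conn) const uv fu≡fv πu<πv =
      merged
    , (merged-isPartition πu<πv isPart (proj₂ (isPart u)) , merged-connected G conn uv refl refl)
    , merged-constant const (trans (sym (const u)) (trans fu≡fv (const v)))
    , merged-repSum< πu<πv (proj₂ (isPart v))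
    where open Merge π (lookup π u) (lookup π v)

  merge-step : ∀ π {u v} → InΠ G π → ConstantOn f π → Adj G u v → f u ≡ f v →
               lookup π u ≢ lookup π v → Improvement π
  merge-step π {u} {v} inΠ const uv fu≡fv πu≢πv with Fin.<-cmp (lookup π u) (lookup π v)
  ... | tri< πu<πv _ _ = merge-along π inΠ const uv fu≡fv πu<πv
  ... | tri≈ _ πu≡πv _ = ⊥-elim (πu≢πv πu≡πv)
  ... | tri> _ _ πv<πu = merge-along π inΠ const (SimpleGraph.sym G uv) (sym fu≡fv) πv<πu

module _ {A : Set} (_≟ᴬ_ : DecidableEquality A) where
  open DecMembership _≟ᴬ_ using (_∈?_)

  length≡∑χ∈ : ∀ {xs ys : List A} → Unique xs → Unique ys → (∀ y → y ∈ ys) →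
               length xs ≡ ∑ ys (λ y → χ (y ∈? xs))
  length≡∑χ∈ {xs} {ys} !xs !ys ∈ys = trans
    (↭-length (∼bag⇒↭ (unique∧set⇒bag !xs (Unique.filter⁺ (_∈? xs) !ys)
      (mk⇔ (λ x∈ → ∈-filter⁺ (_∈? xs) (∈ys _) x∈) (proj₂ ∘ ∈-filter⁻ (_∈? xs) {xs = ys})))))
    (length-filter≡∑χ (_∈? xs) ys)

open import Data.Integer using (ℤ; _+_; _*_; +_)

*-χ : ∀ {p} {P : Set p} x (P? : Dec P) → x * + χ P? ≡ (if does P? then x else + 0)
*-χ x P? with does P?
... | true  = ℤ.*-identityʳ x
... | false = ℤ.*-zeroʳ x

pos-∑ : ∀ {A : Set} (xs : List A) (f : A → ℕ) → + ∑ xs f ≡ ℤ∑.∑ xs (+_ ∘ f)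
pos-∑ []       f = refl
pos-∑ (x ∷ xs) f = trans (ℤ.pos-+ (f x) (∑ xs f)) (cong (_+_ (+ f x)) (pos-∑ xs f))

module LargestConstantPartition {n} (G : SimpleGraph n) {A : Set} (_≟ᴬ_ : DecidableEquality A) (f : Fin n → A)
                                (L : List (PartRep n)) (enum : EnumeratesΠ G L) where
  open Walks G

  ∈L⇒inΠ : ∀ {σ} → σ ∈ L → InΠ G σ
  ∈L⇒inΠ {σ} = proj₁ (proj₂ enum σ)

  inΠ⇒∈L : ∀ σ → InΠ G σ → σ ∈ L
  inΠ⇒∈L σ = proj₂ (proj₂ enum σ)

  largest : PartRep n
  largest = argmin repSum bottom (filter (constantOn? _≟ᴬ_ f) L)

  largest-inΠ×constant : InΠ G largest × ConstantOn f largest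
  largest-inΠ×constant = argmin-all repSum (bottom-inΠ G , λ i → cong f (sym (lookup-bottom i)))
    (All.tabulate λ σ∈ → let σ∈L , const = ∈-filter⁻ (constantOn? _≟ᴬ_ f) σ∈ in ∈L⇒inΠ σ∈L , const)

  largest-inΠ : InΠ G largest
  largest-inΠ = proj₁ largest-inΠ×constant

  largest-constant : ConstantOn f largest
  largest-constant = proj₂ largest-inΠ×constant

  largest-minimal : ∀ {σ} → σ ∈ L → ConstantOn f σ → repSum largest ≤ repSum σ
  largest-minimal σ∈ const = All.lookup (f[argmin]≤f[xs] bottom _) (∈-filter⁺ (constantOn? _≟ᴬ_ f) σ∈ const)

  largest-closed : ∀ {u v} → Adj G u v → f u ≡ f v → SameBlock largest u v
  largest-closed {u} {v} uv fu≡fv with lookup largest u ≟ lookup largest v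
  ... | yes same = same
  ... | no  differ with merge-step G f largest largest-inΠ largest-constant uv fu≡fv differ
  ...   | π′ , inΠ′ , const′ , smaller = ⊥-elim (ℕ.<⇒≱ smaller (largest-minimal (inΠ⇒∈L π′ inΠ′) const′))

  constantOn⇒refines-largest : ∀ σ → InΠ G σ → ConstantOn f σ → Refines σ largest
  constantOn⇒refines-largest σ (_ , conn) const i j σi≡σj with lookup largest i ≟ lookup largest j
  ... | yes same = same
  ... | no  differ with walk-crossing _≟_ (lookup largest) (conn i j σi≡σj) differ
  ...   | u , v , u~i , v~i , uv , differ′ =
          ⊥-elim (differ′ (largest-closed uv (trans (const u) (trans (cong f (trans u~i (sym v~i))) (sym (const v))))))

  refines-largest⇒constantOn : ∀ σ → IsPartition σ → Refines σ largest → ConstantOn f σ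
  refines-largest⇒constantOn σ isPart σ≤largest i = trans (largest-constant i)
    (trans (cong f (σ≤largest i (lookup σ i) (sym (proj₂ (isPart i))))) (sym (largest-constant (lookup σ i))))

  largest≡bottom⇒proper : largest ≡ bottom → Proper G f
  largest≡bottom⇒proper largest≡⊥ i j ij fi≡fj = SimpleGraph.irrefl G (subst (Adj G i) (sym i≡j) ij)
    where
      i≡j : i ≡ j
      i≡j = sameBlock-bottom (subst (λ π → SameBlock π i j) largest≡⊥ (largest-closed ij fi≡fj))

  proper⇒largest≡bottom : Proper G f → largest ≡ bottom
  proper⇒largest≡bottom proper = trans (sym (tabulate∘lookup largest)) (tabulate-cong fixed)
    where
      walk-to-root : ∀ i → WalkIn G (λ w → SameBlock largest w i) i (lookup largest i)
      walk-to-root i = proj₂ largest-inΠ i (lookup largest i) (sym (proj₂ (proj₁ largest-inΠ i)))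
      fixed : ∀ i → lookup largest i ≡ i
      fixed i with lookup largest i ≟ i
      ... | yes fixed = fixed
      ... | no  moved with walk-firstStep (walk-to-root i) (moved ∘ sym)
      ...   | z , iz , z~i = ⊥-elim (proper i z iz
                               (trans (largest-constant i) (trans (cong f (sym z~i)) (sym (largest-constant z)))))

  ∑μ-constantOn : ∀ (μ : PartRep n → ℤ) → IsMöbiusFromBottom L μ → (proper? : Dec (Proper G f)) →
                  ℤ∑.∑ L (λ σ → μ σ * + χ (constantOn? _≟ᴬ_ f σ)) ≡ + χ proper?
  ∑μ-constantOn μ möbius proper? = begin
    ℤ∑.∑ L (λ σ → μ σ * + χ (constantOn? _≟ᴬ_ f σ))
      ≡⟨ ℤ∑.∑-cong-∈ L (λ {σ} σ∈ → cong (λ b → μ σ * + b)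
           (χ-cong (constantOn? _≟ᴬ_ f σ) (refines? σ largest)
             (mk⇔ (constantOn⇒refines-largest σ (∈L⇒inΠ σ∈)) (refines-largest⇒constantOn σ (proj₁ (∈L⇒inΠ σ∈)))))) ⟩
    ℤ∑.∑ L (λ σ → μ σ * + χ (refines? σ largest))
      ≡⟨ ℤ∑.∑-cong L (λ σ → *-χ (μ σ) (refines? σ largest)) ⟩
    ℤ∑.∑ L (λ σ → if does (refines? σ largest) then μ σ else + 0)
      ≡⟨ ℤ∑.∑-filter (λ σ → refines? σ largest) L μ ⟨
    sumℤ (map μ (filter (λ σ → refines? σ largest) L))
      ≡⟨ byProper proper? ⟩
    + χ proper? ∎
    where
      open ≡-Reasoning
      byProper : (p? : Dec (Proper G f)) → sumℤ (map μ (filter (λ σ → refines? σ largest) L)) ≡ + χ p?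
      byProper (yes proper) = proj₁ (möbius largest (inΠ⇒∈L largest largest-inΠ)) (proper⇒largest≡bottom proper)
      byProper (no improper) = proj₂ (möbius largest (inΠ⇒∈L largest largest-inΠ)) (improper ∘ largest≡bottom⇒proper)

∑-*pos : ∀ {A : Set} z (xs : List A) (f : A → ℕ) → ℤ∑.∑ xs (λ x → z * + f x) ≡ z * + ∑ xs f
∑-*pos z xs f = trans (sym (ℤ∑.∑-*ˡ z xs (+_ ∘ f))) (cong (z *_) (sym (pos-∑ xs f)))

sizes : ∀ {k n} → Vec (Subset k) n → Fin n → ℕ
sizes c i = ∣ lookup c i ∣

constantSizes? : ∀ {k n} (c : Vec (Subset k) n) π → Dec (ConstantOn (sizes c) π)
constantSizes? c = constantOn? ℕ._≟_ (sizes c)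

-- For a partition, satisfies? (partitionConstraints π) c unfolds to constantSizes? c π.
∑-constantSizes : ∀ k {n} (π : PartRep n) → IsPartition π →
                  ∑ (vectors (subsets k) n) (λ c → χ (constantSizes? c π)) ≡ blockProduct k π
∑-constantSizes k = SizeConstraints.solutions-partition k

mainTheorem4 : ∀ {n : ℕ} (G : SimpleGraph n) (k : ℕ)
    (C : List (Vec (Subset k) n)) → EnumeratesColorings G k C →
    (L : List (PartRep n)) → EnumeratesΠ G L →
    (μ : PartRep n → ℤ) → IsMöbiusFromBottom L μ →
    + length C ≡ sumℤ (map (λ π → μ π * + blockProduct k π) L)
mainTheorem4 {n} G k C (C-unique , C-colorings) L enum μ möbius = begin
    + length C
      ≡⟨ cong +_ (length≡∑χ∈ _≟ᶜ_ C-unique (vectors-unique n (subsets-unique k)) (∈-vectors ∈-subsets)) ⟩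
    + ∑ colorings (λ c → χ (proper? c))
      ≡⟨ pos-∑ colorings (χ ∘ proper?) ⟩
    ℤ∑.∑ colorings (λ c → + χ (proper? c))
      ≡⟨ ℤ∑.∑-cong colorings (λ c →
           LargestConstantPartition.∑μ-constantOn G ℕ._≟_ (sizes c) L enum μ möbius (proper? c)) ⟨
    ℤ∑.∑ colorings (λ c → ℤ∑.∑ L (λ σ → μ σ * + χ (constantSizes? c σ)))
      ≡⟨ ℤ∑.∑-comm colorings L _ ⟩
    ℤ∑.∑ L (λ σ → ℤ∑.∑ colorings (λ c → μ σ * + χ (constantSizes? c σ)))
      ≡⟨ ℤ∑.∑-cong-∈ L (λ {σ} σ∈L → trans (∑-*pos (μ σ) colorings (λ c → χ (constantSizes? c σ)))
           (cong (λ b → μ σ * + b) (∑-constantSizes k σ (proj₁ (proj₁ (proj₂ enum σ) σ∈L))))) ⟩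
    ℤ∑.∑ L (λ σ → μ σ * + blockProduct k σ) ∎
  where
    open ≡-Reasoning
    _≟ᶜ_ : DecidableEquality (Vec (Subset k) n)
    _≟ᶜ_ = Vec.≡-dec (Vec.≡-dec Bool._≟_)
    open DecMembership _≟ᶜ_ using (_∈?_)
    colorings : List (Vec (Subset k) n)
    colorings = vectors (subsets k) n
    -- Adjacency is not assumed decidable; properness of c is decided through its membership in C.
    proper? : ∀ c → Dec (Proper G (sizes c))
    proper? c = map′ (proj₁ (C-colorings c)) (proj₂ (C-colorings c)) (c ∈? C)
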